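{- Let $D$ be a dense open subset of $\mathrm{Add}(\omega,1)$, where conditions are finite binary strings. Then every condition $p\in\mathrm{Add}(\omega,1)$ has a $D$-immunization.
   Context: $\mathrm{Add}(\omega,1)$ consists of finite binary sequences ordered by extension. For a condition $p$, dense open $D$ and $n\in\omega$, $p$ is $(n,D)$-immune if every condition $q$ with $|q|=|p|$ and $q(i)=p(i)$ for all $i$ with $n\le i<|p|$ belongs to $D$ (i.e. any modification of $p$ on coordinates below $n$ stays in $D$). A condition $q$ is a $D$-immunization of $p$ if $q\le p$ and $q$ is $(|p|,D)$-immune. -}

module Defs where

open import Data.Bool using (Bool)
open import Data.List using (List; []; _∷_; length; _++_)
open import Data.Maybe using (Maybe; just; nothing)
open import Data.Nat using (ℕ; zero; suc; _≤_; _<_)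
open import Data.Product using (Σ; ∃; _×_)
open import Relation.Binary.PropositionalEquality using (_≡_)

Cond : Set
Cond = List Bool

-- q ≤ p  (q is stronger): q extends p, i.e. p is an initial segment of q.
_≤ᶜ_ : Cond → Cond → Set
q ≤ᶜ p = Σ Cond (λ r → q ≡ p ++ r)

_!_ : Cond → ℕ → Maybe Bool
[] ! _ = nothing
(b ∷ p) ! zero = just b
(b ∷ p) ! suc i = p ! i

IsOpen : (Cond → Set) → Set
IsOpen D = ∀ p q → D p → q ≤ᶜ p → D q

IsDense : (Cond → Set) → Set
IsDense D = ∀ p → ∃ (λ q → q ≤ᶜ p × D q)

IsDenseOpen : (Cond → Set) → Set
IsDenseOpen D = IsOpen D × IsDense D

Immune : (Cond → Set) → ℕ → Cond → Set
Immune D n p = ∀ q → length q ≡ length p →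
  (∀ i → n ≤ i → i < length p → q ! i ≡ p ! i) → D q

Immunization : (Cond → Set) → Cond → Cond → Set
Immunization D p q = q ≤ᶜ p × Immune D (length p) q

module Submission where

open import Defs
open import Data.Bool using (true; false)
open import Data.List using ([]; _∷_; length; _++_)
open import Data.List.Properties using (++-assoc)
open import Data.Maybe.Properties using (just-injective)
open import Data.Nat using (ℕ; zero; suc; _≤_; _<_; z≤n; s≤s)
open import Data.Nat.Properties using (suc-injective)
open import Data.Product using (Σ; ∃; _×_; _,_)
open import Function using (_∘_)
open import Relation.Binary.PropositionalEquality
  using (_≡_; refl; sym; cong; cong₂; subst)

-- By induction on n, every condition has an extension t such that s ++ t ∈ D
-- for all 2ⁿ strings s of length n: extend once to handle every s starting
-- with true, then further for those starting with false; openness keeps the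
-- first branch inside D.  With n = |p|, the condition p ++ t is an
-- immunization, because altering it below |p| only replaces the prefix p.

≤ᶜ-trans : ∀ {r q p} → r ≤ᶜ q → q ≤ᶜ p → r ≤ᶜ p
≤ᶜ-trans {p = p} (u , refl) (v , refl) = v ++ u , ++-assoc p v u

++⁺-≤ᶜ : ∀ s {q p} → q ≤ᶜ p → (s ++ q) ≤ᶜ (s ++ p)
++⁺-≤ᶜ s {p = p} (u , refl) = u , sym (++-assoc s p u)

!-extensionality : ∀ (q p : Cond) → length q ≡ length p →
  (∀ i → i < length p → q ! i ≡ p ! i) → q ≡ p
!-extensionality []      []      _  _     = refl
!-extensionality (b ∷ q) (c ∷ p) eq agree =
  cong₂ _∷_ (just-injective (agree zero (s≤s z≤n)))
            (!-extensionality q p (suc-injective eq) (λ i → agree (suc i) ∘ s≤s))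

agreeAbove⇒prefixSwap : ∀ (p t q : Cond) → length q ≡ length (p ++ t) →
  (∀ i → length p ≤ i → i < length (p ++ t) → q ! i ≡ (p ++ t) ! i) →
  Σ Cond (λ s → length s ≡ length p × q ≡ s ++ t)
agreeAbove⇒prefixSwap []      t q       eq agree =
  [] , refl , !-extensionality q t eq (λ i → agree i z≤n)
agreeAbove⇒prefixSwap (b ∷ p) t (c ∷ q) eq agree
  with agreeAbove⇒prefixSwap p t q (suc-injective eq) (λ i i≥ → agree (suc i) (s≤s i≥) ∘ s≤s)
... | s , ∣s∣ , q≡s++t = c ∷ s , cong suc ∣s∣ , cong (c ∷_) q≡s++t

prefixed : (Cond → Set) → Cond → Cond → Set
prefixed D s = D ∘ (s ++_)

prefixed-isDenseOpen : ∀ {D} s → IsDenseOpen D → IsDenseOpen (prefixed D s)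
prefixed-isDenseOpen {D} s (open′ , dense) = isOpen , isDense
  where
  isOpen : IsOpen (prefixed D s)
  isOpen p q Dsp q≤p = open′ (s ++ p) (s ++ q) Dsp (++⁺-≤ᶜ s q≤p)

  isDense : IsDense (prefixed D s)
  isDense p with dense (s ++ p)
  ... | q , (u , refl) , Dq = p ++ u , (u , refl) , subst D (++-assoc s p u) Dq

UniformlyDense : ℕ → (Cond → Set) → Set
UniformlyDense n D =
  ∀ r → ∃ λ t → t ≤ᶜ r × (∀ s → length s ≡ n → D (s ++ t))

denseOpen⇒uniformlyDense : ∀ n {D} → IsDenseOpen D → UniformlyDense n D
denseOpen⇒uniformlyDense zero    (_ , dense) r with dense r
... | t , t≤r , Dt = t , t≤r , λ { [] refl → Dt }
denseOpen⇒uniformlyDense (suc n) {D} dop@(open′ , _) r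
  with denseOpen⇒uniformlyDense n (prefixed-isDenseOpen (true ∷ []) dop) r
... | t₁ , t₁≤r , Dtrue
  with denseOpen⇒uniformlyDense n (prefixed-isDenseOpen (false ∷ []) dop) t₁
... | t₂ , t₂≤t₁ , Dfalse = t₂ , ≤ᶜ-trans t₂≤t₁ t₁≤r , D-all
  where
  D-all : ∀ s → length s ≡ suc n → D (s ++ t₂)
  D-all (true  ∷ s) eq =
    open′ _ _ (Dtrue s (suc-injective eq)) (++⁺-≤ᶜ (true ∷ s) t₂≤t₁)
  D-all (false ∷ s) eq = Dfalse s (suc-injective eq)

proposition5p3 : (D : Cond → Set) → IsDenseOpen D →
    ∀ p → ∃ (λ q → Immunization D p q)
proposition5p3 D dop p with denseOpen⇒uniformlyDense (length p) dop []
... | t , _ , D-all = p ++ t , (t , refl) , immune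
  where
  immune : Immune D (length p) (p ++ t)
  immune q eq agree with agreeAbove⇒prefixSwap p t q eq agree
  ... | s , ∣s∣ , refl = D-all s ∣s∣
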